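{- Let $G$ be a graph with $n$ vertices and $e$ edges such that $e\ge \frac{n^2}{4}+4$. If the minimum degree $\delta$ of $G$ satisfies $$\delta\ge \frac{n}{2}-\sqrt{e-\frac{n^2}{4}}+2,$$ then any two distinct vertices of $G$ are connected by a path of length exactly $4$ in $G$.
   Context: Graphs are finite and simple. A path of length $\ell$ is a path with $\ell$ edges (and $\ell+1$ distinct vertices). -}

module Defs where

open import Data.Nat using (ℕ; zero; suc; _+_; _*_; _≤_)
open import Data.Bool using (Bool; true; false; if_then_else_)
import Data.Bool
open import Data.Fin using (Fin; _<_)
open import Data.Fin.Properties using (_<?_)
open import Data.List using (List; length; filter; allFin; concatMap; map)
open import Data.Product using (_×_; _,_; Σ; ∃-syntax)
open import Relation.Binary.PropositionalEquality using (_≡_; _≢_)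
open import Relation.Nullary.Decidable using (⌊_⌋)
open import Data.Integer as ℤ using (ℤ)
open import Data.Sum using (_⊎_)

record Graph (n : ℕ) : Set where
  field
    adj      : Fin n → Fin n → Bool
    symmetric : ∀ u v → adj u v ≡ adj v u
    irreflexive : ∀ v → adj v v ≡ false
open Graph public

Adj : ∀ {n} → Graph n → Fin n → Fin n → Set
Adj G u v = adj G u v ≡ true

degree : ∀ {n} → Graph n → Fin n → ℕ
degree {n} G v = length (filter (λ u → adj G v u Data.Bool.≟ true) (allFin n))

edgeCount : ∀ {n} → Graph n → ℕ
edgeCount {n} G =
  length (filter (λ p → Data.Bool._≟_ (adjPair p) true)
    (concatMap (λ u → map (λ v → u , v) (allFin n)) (allFin n)))
  where
    adjPair : Fin n × Fin n → Bool
    adjPair (u , v) = if ⌊ u <? v ⌋ then adj G u v else false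

IsMinDegree : ∀ {n} → Graph n → ℕ → Set
IsMinDegree {n} G δ = (∀ v → δ ≤ degree G v) × (∃[ v ] degree G v ≡ δ)

PathOfLength4 : ∀ {n} → Graph n → Fin n → Fin n → Set
PathOfLength4 {n} G x y =
  ∃[ a ] ∃[ b ] ∃[ c ]
    ( Adj G x a × Adj G a b × Adj G b c × Adj G c y
    × x ≢ a × x ≢ b × x ≢ c × x ≢ y
    × a ≢ b × a ≢ c × a ≢ y
    × b ≢ c × b ≢ y
    × c ≢ y )

{-# OPTIONS --safe #-}

-- Fix x ≠ y and let A = N(x) − y and C = N(y) − x; by symmetry ∣A∣ ≤ ∣C∣.  A path
-- x a u c y exists as soon as some u ∉ {x, y} has distinct neighbours a ∈ A and
-- c ∈ C.  Otherwise every such u has deg u + ∣A∣ ≤ n + [u ∈ A ∩ C] and at most one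
-- neighbour in A ∩ C, and vertices of A ∖ C and C ∖ A have no common neighbour.
-- Summing these degree bounds over the partition {x}, {y}, A ∖ C, C ∖ A, A ∩ C and
-- the rest bounds 4e − n² by a quadratic in the class sizes, while δ ≤ deg x ≤ ∣A∣ + 1
-- bounds n + 4 − 2δ from below.  A case analysis comparing ∣A ∩ C∣ with
-- ∣C ∖ A∣ − ∣A ∖ C∣ + ∣rest∣ then contradicts 4e − n² ≥ 16 or 4e − n² ≥ (n + 4 − 2δ)².

module Submission where

open import Defs
open import Data.Nat using (ℕ)
open import Data.Fin using (Fin)
open import Data.Sum using (_⊎_)
open import Relation.Binary.PropositionalEquality using (_≢_)

module Counting where

  open import Data.Nat using (ℕ; zero; suc; _+_; _*_; _∸_; _≤_; _⊔_; z≤n)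
  open import Data.Nat.Properties hiding (_≟_)
  open import Data.Bool using (Bool; true; false; _∧_; _∨_; not)
  open import Data.Bool.Properties using (¬-not; ∧-comm)
  import Data.Bool as Bool
  open import Data.Fin using (Fin; zero; suc)
  open import Data.Fin.Properties using (_≟_; any?)
  open import Data.Product using (_×_; _,_; proj₂; ∃-syntax)
  open import Data.Sum using (_⊎_; inj₁; inj₂)
  open import Data.List using (List; []; _∷_; map)
  open import Data.List.Properties using (map-cong)
  import Data.Nat.ListAction as ListAction
  open import Function using (_∘_)
  open import Relation.Binary.PropositionalEquality
  open import Relation.Nullary using (yes; no; does)
  open import Relation.Nullary.Decidable using (dec-true; dec-false)
  open import Relation.Nullary.Negation using (contradiction)
  open import Algebra.Properties.Semiring.Sum +-*-semiring
    using (sum; sum-syntax; sum-cong-≗; sum-replicate-zero; ∑-distrib-+; *-distribʳ-sum)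

  iverson : Bool → ℕ
  iverson true  = 1
  iverson false = 0

  iverson≤1 : ∀ b → iverson b ≤ 1
  iverson≤1 true  = ≤-refl
  iverson≤1 false = z≤n

  iverson-∧ : ∀ a b → iverson (a ∧ b) ≡ iverson a * iverson b
  iverson-∧ true  b = sym (*-identityˡ (iverson b))
  iverson-∧ false b = refl

  sum-mono-≤ : ∀ {n} {f g : Fin n → ℕ} → (∀ i → f i ≤ g i) → sum f ≤ sum g
  sum-mono-≤ {zero}  f≤g = z≤n
  sum-mono-≤ {suc n} f≤g = +-mono-≤ (f≤g zero) (sum-mono-≤ (f≤g ∘ suc))

  sum-1 : ∀ n → ∑[ i < n ] 1 ≡ n
  sum-1 zero    = refl
  sum-1 (suc n) = cong suc (sum-1 n)

  module _ {n : ℕ} where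

    infixr 7 _∩_
    infixr 6 _∪_ _∖_

    _∩_ _∪_ _∖_ : (Fin n → Bool) → (Fin n → Bool) → Fin n → Bool
    (P ∩ Q) v = P v ∧ Q v
    (P ∪ Q) v = P v ∨ Q v
    (P ∖ Q) v = P v ∧ not (Q v)

    ∁ : (Fin n → Bool) → Fin n → Bool
    ∁ P v = not (P v)

    ｛_｝ : Fin n → Fin n → Bool
    ｛ v ｝ i = does (i ≟ v)

    ∣_∣ : (Fin n → Bool) → ℕ
    ∣ P ∣ = ∑[ v < n ] iverson (P v)

    sumOn : (Fin n → Bool) → (Fin n → ℕ) → ℕ
    sumOn P f = ∑[ v < n ] (iverson (P v) * f v)

    ∣P∣≤n : ∀ P → ∣ P ∣ ≤ n
    ∣P∣≤n P = ≤-trans (sum-mono-≤ (iverson≤1 ∘ P)) (≤-reflexive (sum-1 n))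

    ∣∣-mono : ∀ {P Q} → (∀ v → P v ≡ true → Q v ≡ true) → ∣ P ∣ ≤ ∣ Q ∣
    ∣∣-mono {P} {Q} P⊆Q = sum-mono-≤ pointwise
      where
      pointwise : ∀ v → iverson (P v) ≤ iverson (Q v)
      pointwise v with P v in Pv
      ... | true  rewrite P⊆Q v Pv = ≤-refl
      ... | false = z≤n

    ∣P∣+∣Q∣≡∣P∪Q∣+∣P∩Q∣ : ∀ P Q → ∣ P ∣ + ∣ Q ∣ ≡ ∣ P ∪ Q ∣ + ∣ P ∩ Q ∣
    ∣P∣+∣Q∣≡∣P∪Q∣+∣P∩Q∣ P Q = begin
      ∣ P ∣ + ∣ Q ∣                                          ≡⟨ ∑-distrib-+ (iverson ∘ P) (iverson ∘ Q) ⟨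
      ∑[ v < n ] (iverson (P v) + iverson (Q v))             ≡⟨ sum-cong-≗ (λ v → pointwise (P v) (Q v)) ⟩
      ∑[ v < n ] (iverson (P v ∨ Q v) + iverson (P v ∧ Q v)) ≡⟨ ∑-distrib-+ (iverson ∘ (P ∪ Q)) (iverson ∘ (P ∩ Q)) ⟩
      ∣ P ∪ Q ∣ + ∣ P ∩ Q ∣                                  ∎
      where
      open ≡-Reasoning
      pointwise : ∀ a b → iverson a + iverson b ≡ iverson (a ∨ b) + iverson (a ∧ b)
      pointwise true  true  = refl
      pointwise true  false = refl
      pointwise false b     = +-comm 0 (iverson b)

    ∣P∣+∣Q∣≤n+∣P∩Q∣ : ∀ P Q → ∣ P ∣ + ∣ Q ∣ ≤ n + ∣ P ∩ Q ∣
    ∣P∣+∣Q∣≤n+∣P∩Q∣ P Q = ≤-trans (≤-reflexive (∣P∣+∣Q∣≡∣P∪Q∣+∣P∩Q∣ P Q)) (+-monoˡ-≤ ∣ P ∩ Q ∣ (∣P∣≤n (P ∪ Q)))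

    ∣P∣≡∣P∖Q∣+∣P∩Q∣ : ∀ P Q → ∣ P ∣ ≡ ∣ P ∖ Q ∣ + ∣ P ∩ Q ∣
    ∣P∣≡∣P∖Q∣+∣P∩Q∣ P Q = trans (sum-cong-≗ (λ v → pointwise (P v) (Q v)))
                                 (∑-distrib-+ (iverson ∘ (P ∖ Q)) (iverson ∘ (P ∩ Q)))
      where
      pointwise : ∀ a b → iverson a ≡ iverson (a ∧ not b) + iverson (a ∧ b)
      pointwise true  true  = refl
      pointwise true  false = refl
      pointwise false b     = refl

    ∣P∩Q∣≡∣Q∩P∣ : ∀ P Q → ∣ P ∩ Q ∣ ≡ ∣ Q ∩ P ∣
    ∣P∩Q∣≡∣Q∩P∣ P Q = sum-cong-≗ (λ v → cong iverson (∧-comm (P v) (Q v)))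

    member-or-∣∣≡0 : ∀ P → (∃[ v ] P v ≡ true) ⊎ ∣ P ∣ ≡ 0
    member-or-∣∣≡0 P with any? (λ v → P v Bool.≟ true)
    ... | yes member = inj₁ member
    ... | no  none   = inj₂ (trans (sum-cong-≗ (λ v → cong iverson (¬-not (λ Pv → none (v , Pv)))))
                                   (sum-replicate-zero n))

    sumOn-1 : ∀ P → sumOn P (λ _ → 1) ≡ ∣ P ∣
    sumOn-1 P = sum-cong-≗ (λ v → *-identityʳ (iverson (P v)))

    sumOn-≤ : ∀ {P f M} → (∀ v → P v ≡ true → f v ≤ M) → sumOn P f ≤ ∣ P ∣ * M
    sumOn-≤ {P} {f} {M} f≤M = begin
      sumOn P f                      ≤⟨ sum-mono-≤ pointwise ⟩
      ∑[ v < n ] (iverson (P v) * M) ≡⟨ *-distribʳ-sum M (iverson ∘ P) ⟨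
      ∣ P ∣ * M                      ∎
      where
      open ≤-Reasoning
      pointwise : ∀ v → iverson (P v) * f v ≤ iverson (P v) * M
      pointwise v with P v in Pv
      ... | true  = *-monoʳ-≤ 1 (f≤M v Pv)
      ... | false = z≤n

    ∣P∩Q∣≡sumOn : ∀ P Q → ∣ P ∩ Q ∣ ≡ sumOn P (iverson ∘ Q)
    ∣P∩Q∣≡sumOn P Q = sum-cong-≗ (λ v → iverson-∧ (P v) (Q v))

  module _ {n : ℕ} (P Q : Fin n → Bool) {v : Fin n} where

    ∩-elim : (P ∩ Q) v ≡ true → P v ≡ true × Q v ≡ true
    ∩-elim P∩Qv with P v | Q v
    ... | true | true = refl , refl

    ∩-intro : P v ≡ true → Q v ≡ true → (P ∩ Q) v ≡ true
    ∩-intro Pv Qv rewrite Pv | Qv = refl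

    ∖-elim : (P ∖ Q) v ≡ true → P v ≡ true × Q v ≡ false
    ∖-elim P∖Qv with P v | Q v
    ... | true | false = refl , refl

    ∖-intro : P v ≡ true → Q v ≡ false → (P ∖ Q) v ≡ true
    ∖-intro Pv Qv rewrite Pv | Qv = refl

  ｛｝-intro : ∀ {n} {v w : Fin n} → v ≢ w → ｛ w ｝ v ≡ false
  ｛｝-intro {v = v} {w} = dec-false (v ≟ w)

  ｛｝-elim : ∀ {n} {v w : Fin n} → ｛ w ｝ v ≡ false → v ≢ w
  ｛｝-elim {v = v} v∉｛w｝ refl = contradiction (trans (sym (dec-true (v ≟ v) refl)) v∉｛w｝) λ ()

  sumOn-｛｝ : ∀ {n} (v : Fin n) f → sumOn ｛ v ｝ f ≡ f v
  sumOn-｛｝ {suc n} zero    f = begin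
    1 * f zero + ∑[ i < n ] 0 ≡⟨ cong (1 * f zero +_) (sum-replicate-zero n) ⟩
    1 * f zero + 0            ≡⟨ +-identityʳ _ ⟩
    1 * f zero                ≡⟨ *-identityˡ (f zero) ⟩
    f zero                    ∎
    where open ≡-Reasoning
  sumOn-｛｝ {suc n} (suc v) f = sumOn-｛｝ v (f ∘ suc)

  ∣｛v｝∣≡1 : ∀ {n} (v : Fin n) → ∣ ｛ v ｝ ∣ ≡ 1
  ∣｛v｝∣≡1 v = trans (sym (sumOn-1 ｛ v ｝)) (sumOn-｛｝ v (λ _ → 1))

  ∣P∣≤1 : ∀ {n} {P : Fin n → Bool} a → (∀ v → P v ≡ true → v ≡ a) → ∣ P ∣ ≤ 1
  ∣P∣≤1 a P⊆｛a｝ = ≤-trans (∣∣-mono (λ v Pv → dec-true (v ≟ a) (P⊆｛a｝ v Pv))) (≤-reflexive (∣｛v｝∣≡1 a))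

  ∣P∣≤∣P∖｛v｝∣+1 : ∀ {n} (P : Fin n → Bool) v → ∣ P ∣ ≤ ∣ P ∖ ｛ v ｝ ∣ + 1
  ∣P∣≤∣P∖｛v｝∣+1 P v = begin
    ∣ P ∣                             ≡⟨ ∣P∣≡∣P∖Q∣+∣P∩Q∣ P ｛ v ｝ ⟩
    ∣ P ∖ ｛ v ｝ ∣ + ∣ P ∩ ｛ v ｝ ∣  ≤⟨ +-monoʳ-≤ ∣ P ∖ ｛ v ｝ ∣ (∣∣-mono (λ w → proj₂ ∘ ∩-elim P ｛ v ｝ {w})) ⟩
    ∣ P ∖ ｛ v ｝ ∣ + ∣ ｛ v ｝ ∣      ≡⟨ cong (∣ P ∖ ｛ v ｝ ∣ +_) (∣｛v｝∣≡1 v) ⟩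
    ∣ P ∖ ｛ v ｝ ∣ + 1               ∎
    where open ≤-Reasoning

  sum-partition : ∀ {n} (Ps : List (Fin n → Bool)) →
    (∀ v → ListAction.sum (map (λ P → iverson (P v)) Ps) ≡ 1) →
    ∀ f → sum f ≡ ListAction.sum (map (λ P → sumOn P f) Ps)
  sum-partition {n} Ps partition f = trans (sum-cong-≗ weight-1) (distribute Ps)
    where
    weight : List (Fin n → Bool) → Fin n → ℕ
    weight Qs v = ListAction.sum (map (λ P → iverson (P v)) Qs)

    weight-1 : ∀ v → f v ≡ weight Ps v * f v
    weight-1 v = trans (sym (*-identityˡ (f v))) (cong (_* f v) (sym (partition v)))

    distribute : ∀ Qs → ∑[ v < n ] (weight Qs v * f v) ≡ ListAction.sum (map (λ P → sumOn P f) Qs)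
    distribute []       = sum-replicate-zero n
    distribute (Q ∷ Qs) = begin
      ∑[ v < n ] ((iverson (Q v) + weight Qs v) * f v)     ≡⟨ sum-cong-≗ (λ v → *-distribʳ-+ (f v) (iverson (Q v)) _) ⟩
      ∑[ v < n ] (iverson (Q v) * f v + weight Qs v * f v) ≡⟨ ∑-distrib-+ (λ v → iverson (Q v) * f v) _ ⟩
      sumOn Q f + ∑[ v < n ] (weight Qs v * f v)           ≡⟨ cong (sumOn Q f +_) (distribute Qs) ⟩
      sumOn Q f + ListAction.sum (map (λ P → sumOn P f) Qs) ∎
      where open ≡-Reasoning

  n≡∑∣class∣ : ∀ {n} (Ps : List (Fin n → Bool)) →
    (∀ v → ListAction.sum (map (λ P → iverson (P v)) Ps) ≡ 1) → n ≡ ListAction.sum (map ∣_∣ Ps)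
  n≡∑∣class∣ {n} Ps partition = begin
    n                                                  ≡⟨ sum-1 n ⟨
    ∑[ v < n ] 1                                       ≡⟨ sum-partition Ps partition (λ _ → 1) ⟩
    ListAction.sum (map (λ P → sumOn P (λ _ → 1)) Ps) ≡⟨ cong ListAction.sum (map-cong sumOn-1 Ps) ⟩
    ListAction.sum (map ∣_∣ Ps)                        ∎
    where open ≡-Reasoning

  maxOn : ∀ {n} → (Fin n → Bool) → (Fin n → ℕ) → ℕ
  maxOn {zero}  P f = 0
  maxOn {suc n} P f = iverson (P zero) * f zero ⊔ maxOn (P ∘ suc) (f ∘ suc)

  ≤-maxOn : ∀ {n} {P : Fin n → Bool} {f} v → P v ≡ true → f v ≤ maxOn P f
  ≤-maxOn {suc n} {P} {f} zero    Pv rewrite Pv = ≤-trans (≤-reflexive (sym (*-identityˡ (f zero)))) (m≤m⊔n _ _)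
  ≤-maxOn {suc n}         (suc v) Pv = ≤-trans (≤-maxOn v Pv) (m≤n⊔m _ _)

  maxOn-lub : ∀ {n} {P : Fin n → Bool} {f M} → (∀ v → P v ≡ true → f v ≤ M) → maxOn P f ≤ M
  maxOn-lub {zero}              f≤M = z≤n
  maxOn-lub {suc n} {P} {f} {M} f≤M = ⊔-lub head (maxOn-lub (f≤M ∘ suc))
    where
    head : iverson (P zero) * f zero ≤ M
    head with P zero in P0
    ... | true  = ≤-trans (≤-reflexive (*-identityˡ (f zero))) (f≤M zero P0)
    ... | false = z≤n

  private
    weighted-mean-≤ : ∀ {p q β N L} → p ≤ q → β ≤ N → β ≤ L → p * (N ∸ β) + q * β ≤ p * N + (q ∸ p) * L
    weighted-mean-≤ {p} {q} {β} {N} {L} p≤q β≤N β≤L = begin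
      p * (N ∸ β) + q * β                   ≡⟨ cong (λ q → p * (N ∸ β) + q * β) (m+[n∸m]≡n p≤q) ⟨
      p * (N ∸ β) + (p + (q ∸ p)) * β       ≡⟨ cong (p * (N ∸ β) +_) (*-distribʳ-+ β p (q ∸ p)) ⟩
      p * (N ∸ β) + (p * β + (q ∸ p) * β)   ≡⟨ +-assoc (p * (N ∸ β)) (p * β) _ ⟨
      p * (N ∸ β) + p * β + (q ∸ p) * β     ≡⟨ cong (_+ (q ∸ p) * β) (*-distribˡ-+ p (N ∸ β) β) ⟨
      p * (N ∸ β + β) + (q ∸ p) * β         ≡⟨ cong (λ m → p * m + (q ∸ p) * β) (m∸n+n≡m β≤N) ⟩
      p * N + (q ∸ p) * β                   ≤⟨ +-monoʳ-≤ (p * N) (*-monoʳ-≤ (q ∸ p) β≤L) ⟩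
      p * N + (q ∸ p) * L                   ∎
      where open ≤-Reasoning

  -- With β the largest value of f on Q, every value of f on P is at most N ∸ β.
  sumOn-pair-≤ : ∀ {n} {P Q : Fin n → Bool} {f : Fin n → ℕ} {N L} → ∣ P ∣ ≤ ∣ Q ∣ →
    (∀ v → f v ≤ N) → (∀ c → Q c ≡ true → f c ≤ L) →
    (∀ a c → P a ≡ true → Q c ≡ true → f a + f c ≤ N) →
    sumOn P f + sumOn Q f ≤ ∣ P ∣ * N + (∣ Q ∣ ∸ ∣ P ∣) * L
  sumOn-pair-≤ {P = P} {Q} {f} {N} {L} ∣P∣≤∣Q∣ f≤N f≤L pair-≤ = begin
    sumOn P f + sumOn Q f           ≤⟨ +-mono-≤ (sumOn-≤ on-P) (sumOn-≤ {P = Q} {f} (λ c → ≤-maxOn c)) ⟩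
    ∣ P ∣ * (N ∸ β) + ∣ Q ∣ * β     ≤⟨ weighted-mean-≤ ∣P∣≤∣Q∣ (maxOn-lub (λ c _ → f≤N c)) (maxOn-lub f≤L) ⟩
    ∣ P ∣ * N + (∣ Q ∣ ∸ ∣ P ∣) * L ∎
    where
    open ≤-Reasoning
    β : ℕ
    β = maxOn Q f
    on-P : ∀ a → P a ≡ true → f a ≤ N ∸ β
    on-P a Pa = m+n≤o⇒m≤o∸n (f a) (subst (_≤ N) (+-comm β (f a)) (m≤o∸n⇒m+n≤o β (f≤N a)
      (maxOn-lub (λ c Qc → m+n≤o⇒m≤o∸n (f c) (subst (_≤ N) (+-comm (f a) (f c)) (pair-≤ a c Pa Qc))))))

module GraphCounting where

  open Counting
  open import Data.Nat using (ℕ; zero; suc; _+_; _*_; _≤_)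
  open import Data.Nat.Properties hiding (_≟_; _<?_; <-cmp; <-asym)
  open import Data.Bool using (Bool; true; false; _∧_; if_then_else_)
  import Data.Bool as Bool
  open import Data.Fin using (Fin; zero; suc)
  open import Data.Fin.Properties using (_≟_; _<?_; <-cmp; <-asym)
  open import Data.List using (List; _++_; length; filter; tabulate; concatMap; map; allFin)
  open import Data.List.Properties using (filter-++; length-++; map-tabulate)
  open import Data.Product using (_×_; _,_)
  open import Function using (_∘_; id)
  open import Relation.Binary.PropositionalEquality
  open import Relation.Binary.Definitions using (tri<; tri≈; tri>)
  open import Relation.Nullary using (yes; no)
  open import Relation.Nullary.Decidable using (⌊_⌋)
  open import Relation.Nullary.Negation using (contradiction)
  open import Algebra.Properties.Semiring.Sum +-*-semiring
    using (sum-syntax; sum-cong-≗; ∑-distrib-+; ∑-comm; *-distribˡ-sum)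

  module _ {A : Set} (P : A → Bool) where

    private
      count : List A → ℕ
      count xs = length (filter (λ a → P a Bool.≟ true) xs)

    count-tabulate : ∀ {n} (f : Fin n → A) → count (tabulate f) ≡ ∑[ i < n ] iverson (P (f i))
    count-tabulate {zero}  f = refl
    count-tabulate {suc n} f with P (f zero)
    ... | true  = cong suc (count-tabulate (f ∘ suc))
    ... | false = count-tabulate (f ∘ suc)

    count-concatMap-tabulate : ∀ {B : Set} {n} (g : B → List A) (f : Fin n → B) →
      count (concatMap g (tabulate f)) ≡ ∑[ i < n ] count (g (f i))
    count-concatMap-tabulate {n = zero}  g f = refl
    count-concatMap-tabulate {n = suc n} g f = begin
      count (g (f zero) ++ concatMap g (tabulate (f ∘ suc)))
        ≡⟨ cong length (filter-++ _ (g (f zero)) _) ⟩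
      length (filter _ (g (f zero)) ++ filter _ (concatMap g (tabulate (f ∘ suc))))
        ≡⟨ length-++ (filter _ (g (f zero))) ⟩
      count (g (f zero)) + count (concatMap g (tabulate (f ∘ suc)))
        ≡⟨ cong (count (g (f zero)) +_) (count-concatMap-tabulate g (f ∘ suc)) ⟩
      count (g (f zero)) + ∑[ i < n ] count (g (f (suc i)))
        ∎
      where open ≡-Reasoning

  module _ {n : ℕ} (G : Graph n) where

    Adj-sym : ∀ {u v} → Adj G u v → Adj G v u
    Adj-sym {u} {v} uv = trans (symmetric G v u) uv

    Adj⇒≢ : ∀ {u v} → Adj G u v → u ≢ v
    Adj⇒≢ {u} uu refl = contradiction (trans (sym uu) (irreflexive G u)) λ ()

    degree≡∣adj∣ : ∀ v → degree G v ≡ ∣ adj G v ∣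
    degree≡∣adj∣ v = count-tabulate (adj G v) id

    degree≤n : ∀ u → degree G u ≤ n
    degree≤n u rewrite degree≡∣adj∣ u = ∣P∣≤n (adj G u)

    degree≤∣N∖v∣+1 : ∀ u v → degree G u ≤ ∣ adj G u ∖ ｛ v ｝ ∣ + 1
    degree≤∣N∖v∣+1 u v rewrite degree≡∣adj∣ u = ∣P∣≤∣P∖｛v｝∣+1 (adj G u) v

    private
      E : Fin n → Fin n → Bool
      E u v = if ⌊ u <? v ⌋ then adj G u v else false

      edgeCount≡ : edgeCount G ≡ ∑[ u < n ] ∑[ v < n ] iverson (E u v)
      edgeCount≡ = trans (count-concatMap-tabulate E′ (λ u → map (u ,_) (allFin n)) id) (sum-cong-≗ λ u →
        trans (cong (λ ps → length (filter (λ p → E′ p Bool.≟ true) ps)) (map-tabulate {n = n} id (u ,_)))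
              (count-tabulate E′ (u ,_)))
        where
        E′ : Fin n × Fin n → Bool
        E′ (u , v) = E u v

      adj-split : ∀ u v → iverson (adj G u v) ≡ iverson (E u v) + iverson (E v u)
      adj-split u v with u <? v | v <? u
      ... | yes u<v | yes v<u = contradiction v<u (<-asym u<v)
      ... | yes _   | no  _   = sym (+-identityʳ _)
      ... | no  _   | yes _   = cong iverson (symmetric G u v)
      ... | no  u≮v | no  v≮u with <-cmp u v
      ...   | tri< u<v _    _   = contradiction u<v u≮v
      ...   | tri> _    _   v<u = contradiction v<u v≮u
      ...   | tri≈ _    refl _  = cong iverson (irreflexive G u)

    handshake : ∑[ v < n ] degree G v ≡ 2 * edgeCount G
    handshake = begin
      ∑[ u < n ] degree G u
        ≡⟨ sum-cong-≗ degree≡∣adj∣ ⟩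
      ∑[ u < n ] ∑[ v < n ] iverson (adj G u v)
        ≡⟨ sum-cong-≗ (λ u → sum-cong-≗ (adj-split u)) ⟩
      ∑[ u < n ] ∑[ v < n ] (iverson (E u v) + iverson (E v u))
        ≡⟨ sum-cong-≗ (λ u → ∑-distrib-+ (iverson ∘ E u) _) ⟩
      ∑[ u < n ] (∑[ v < n ] iverson (E u v) + ∑[ v < n ] iverson (E v u))
        ≡⟨ ∑-distrib-+ (λ u → ∑[ v < n ] iverson (E u v)) _ ⟩
      m + ∑[ u < n ] ∑[ v < n ] iverson (E v u)
        ≡⟨ cong (m +_) (∑-comm (λ u v → iverson (E v u))) ⟩
      m + m
        ≡⟨ cong (λ e → e + e) edgeCount≡ ⟨
      edgeCount G + edgeCount G
        ≡⟨ cong (edgeCount G +_) (+-identityʳ _) ⟨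
      2 * edgeCount G
        ∎
      where
      open ≡-Reasoning
      m : ℕ
      m = ∑[ u < n ] ∑[ v < n ] iverson (E u v)

    sumOn-degree : ∀ P → sumOn P (degree G) ≡ ∑[ w < n ] ∣ adj G w ∩ P ∣
    sumOn-degree P = begin
      ∑[ v < n ] (iverson (P v) * degree G v)
        ≡⟨ sum-cong-≗ (λ v → cong (iverson (P v) *_) (degree≡∣adj∣ v)) ⟩
      ∑[ v < n ] (iverson (P v) * ∑[ w < n ] iverson (adj G v w))
        ≡⟨ sum-cong-≗ (λ v → *-distribˡ-sum (iverson (P v)) (iverson ∘ adj G v)) ⟩
      ∑[ v < n ] ∑[ w < n ] (iverson (P v) * iverson (adj G v w))
        ≡⟨ ∑-comm (λ v w → iverson (P v) * iverson (adj G v w)) ⟩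
      ∑[ w < n ] ∑[ v < n ] (iverson (P v) * iverson (adj G v w))
        ≡⟨ sum-cong-≗ (λ w → sum-cong-≗ (λ v → edge-weight w v)) ⟩
      ∑[ w < n ] ∣ adj G w ∩ P ∣
        ∎
      where
      open ≡-Reasoning
      edge-weight : ∀ w v → iverson (P v) * iverson (adj G v w) ≡ iverson (adj G w v ∧ P v)
      edge-weight w v = begin
        iverson (P v) * iverson (adj G v w)   ≡⟨ *-comm (iverson (P v)) _ ⟩
        iverson (adj G v w) * iverson (P v)   ≡⟨ cong (λ b → iverson b * iverson (P v)) (symmetric G v w) ⟩
        iverson (adj G w v) * iverson (P v)   ≡⟨ iverson-∧ (adj G w v) (P v) ⟨
        iverson (adj G w v ∧ P v)             ∎

    degree+∣P∣≤n+∣N∩P∣ : ∀ u P → degree G u + ∣ P ∣ ≤ n + ∣ adj G u ∩ P ∣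
    degree+∣P∣≤n+∣N∩P∣ u P rewrite degree≡∣adj∣ u = ∣P∣+∣Q∣≤n+∣P∩Q∣ (adj G u) P

    degree+∣P∣≤n : ∀ {u} P → P u ≡ false → ∣ adj G u ∩ P ∣ ≤ 1 → degree G u + ∣ P ∣ ≤ n
    degree+∣P∣≤n {u} P Pu ∣N∩P∣≤1 = +-cancelʳ-≤ 1 (degree G u + ∣ P ∣) n (begin
      degree G u + ∣ P ∣ + 1                  ≡⟨ +-assoc (degree G u) ∣ P ∣ 1 ⟩
      degree G u + (∣ P ∣ + 1)                ≡⟨ cong (degree G u +_) ∣P∣+1≡∣u∪P∣ ⟩
      degree G u + ∣ ｛ u ｝ ∪ P ∣           ≤⟨ degree+∣P∣≤n+∣N∩P∣ u (｛ u ｝ ∪ P) ⟩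
      n + ∣ adj G u ∩ (｛ u ｝ ∪ P) ∣        ≤⟨ +-monoʳ-≤ n (∣∣-mono loop-free) ⟩
      n + ∣ adj G u ∩ P ∣                     ≤⟨ +-monoʳ-≤ n ∣N∩P∣≤1 ⟩
      n + 1                                   ∎)
      where
      open ≤-Reasoning
      ∣P∣+1≡∣u∪P∣ : ∣ P ∣ + 1 ≡ ∣ ｛ u ｝ ∪ P ∣
      ∣P∣+1≡∣u∪P∣ = begin-equality
        ∣ P ∣ + 1                             ≡⟨ +-comm (∣ P ∣) 1 ⟩
        1 + ∣ P ∣                             ≡⟨ cong (_+ ∣ P ∣) (∣｛v｝∣≡1 u) ⟨
        ∣ ｛ u ｝ ∣ + ∣ P ∣                   ≡⟨ ∣P∣+∣Q∣≡∣P∪Q∣+∣P∩Q∣ ｛ u ｝ P ⟩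
        ∣ ｛ u ｝ ∪ P ∣ + ∣ ｛ u ｝ ∩ P ∣
          ≡⟨ cong (∣ ｛ u ｝ ∪ P ∣ +_) (trans (∣P∩Q∣≡sumOn ｛ u ｝ P) (sumOn-｛｝ u (iverson ∘ P))) ⟩
        ∣ ｛ u ｝ ∪ P ∣ + iverson (P u)        ≡⟨ cong (λ b → ∣ ｛ u ｝ ∪ P ∣ + iverson b) Pu ⟩
        ∣ ｛ u ｝ ∪ P ∣ + 0                   ≡⟨ +-identityʳ _ ⟩
        ∣ ｛ u ｝ ∪ P ∣                       ∎
      loop-free : ∀ v → (adj G u ∩ (｛ u ｝ ∪ P)) v ≡ true → (adj G u ∩ P) v ≡ true
      loop-free v uv with v ≟ u | adj G u v in e
      ... | yes refl | true  = contradiction (trans (sym e) (irreflexive G u)) λ ()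
      ... | no  _    | true  = uv

module Arithmetic where

  open import Data.Nat using (ℕ; zero; suc; _+_; _*_; _∸_; _≤_; s≤s)
  open import Data.Nat.Properties
  open import Data.Nat.Tactic.RingSolver using (solve-∀)
  open import Data.Product using (_,_)
  open import Data.Sum using (_⊎_; inj₁; inj₂)
  open import Data.Empty using (⊥)
  open import Relation.Binary.PropositionalEquality
  open import Relation.Nullary using (¬_)
  open import Relation.Nullary.Negation using (contradiction)

  slack⇒≰ : ∀ {a b c} → a + suc c ≡ b → ¬ (b ≤ a)
  slack⇒≰ {a} {c = c} a+c+1≡b = <⇒≱ (≤-trans (s≤s (m≤m+n a c)) (≤-reflexive (trans (sym (+-suc a c)) a+c+1≡b)))

  ≤-trans-cancel : ∀ T N R {X Q S} → X + Q ≤ N + (R + 2 * S) → T + N ≤ X → ∀ {β} → S ≤ β → T + Q ≤ R + 2 * β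
  ≤-trans-cancel T N R {X} {Q} {S} X+Q≤ T+N≤X {β} S≤β = +-cancelˡ-≤ N (T + Q) (R + 2 * β) (begin
    N + (T + Q)         ≡⟨ +-assoc N T Q ⟨
    N + T + Q           ≡⟨ cong (_+ Q) (+-comm N T) ⟩
    T + N + Q           ≤⟨ +-monoˡ-≤ Q T+N≤X ⟩
    X + Q               ≤⟨ X+Q≤ ⟩
    N + (R + 2 * S)     ≤⟨ +-monoʳ-≤ N (+-monoʳ-≤ R (*-monoʳ-≤ 2 S≤β)) ⟩
    N + (R + 2 * β)     ∎)
    where open ≤-Reasoning

  data Dichotomy : ℕ → ℕ → Set where
    k≤m : ∀ k d → Dichotomy k (k + d)
    k>m : ∀ m w → Dichotomy (suc (m + w)) m

  dichotomy : ∀ k m → Dichotomy k m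
  dichotomy zero    m       = k≤m zero m
  dichotomy (suc k) zero    = k>m zero k
  dichotomy (suc k) (suc m) with dichotomy k m
  ... | k≤m .k d = k≤m (suc k) d
  ... | k>m .m w = k>m (suc m) w

  -- In each case below the bound t² + Q ≤ R + 2β (with 16 for t² when k > m) fails by 1 + c,
  -- where the polynomial c has nonnegative coefficients.
  module Gap where
    k≡0 : ∀ p d → d * (d + 2) + 2 * (0 * (3 + p + d)) + suc (6 * d + 15)
                ≡ (4 + d) * (4 + d) + (0 * 0 + 2 * 0 * (p + d))
    k≡0 = solve-∀
    k≡1 : ∀ p d → (1 + d) * (1 + d + 2) + 2 * (1 * (3 + p + (1 + d))) + suc (4 * d + 7)
                ≡ (4 + d) * (4 + d) + (1 * 1 + 2 * 1 * (p + (1 + d)))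
    k≡1 = solve-∀
    k≡2 : ∀ p d → (2 + d) * (2 + d + 2) + 2 * (2 * p + (2 + d) + 3 * 2) + suc (4 * d + 3)
                ≡ (4 + d) * (4 + d) + (2 * 2 + 2 * 2 * (p + (2 + d)))
    k≡2 = solve-∀
    3≤k≤m : ∀ p i d → (3 + i + d) * (3 + i + d + 2) + 2 * (2 * p + (3 + i + d) + 3 * (3 + i))
                        + suc (3 + 2 * p + 2 * p * i + 2 * i + 2 * i * i + 4 * d)
                    ≡ (4 + d) * (4 + d) + ((3 + i) * (3 + i) + 2 * (3 + i) * (p + (3 + i + d)))
    3≤k≤m = solve-∀
    k≡1∧m≡0 : ∀ p → 0 * (0 + 2) + 2 * (1 * (3 + p + 0)) + suc 10 ≡ 16 + (1 * 1 + 2 * 1 * (p + 0))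
    k≡1∧m≡0 = solve-∀
    k≡2∧m≡0 : ∀ p → 0 * (0 + 2) + 2 * (2 * p + 0 + 3 * 2) + suc 7 ≡ 16 + (2 * 2 + 2 * 2 * (p + 0))
    k≡2∧m≡0 = solve-∀
    3≤k∧m≡0 : ∀ p b → 0 * (0 + 2) + 2 * (2 * p + 0 + 3 * (3 + b)) + suc (2 * p + 2 * p * b + b * b + 6)
                    ≡ 16 + ((3 + b) * (3 + b) + 2 * (3 + b) * (p + 0))
    3≤k∧m≡0 = solve-∀
    m≡1<k : ∀ p w → 1 * (1 + 2) + 2 * (2 * p + 1 + 3 * (2 + w)) + suc (2 * p * w + w * w + 6)
                  ≡ 16 + ((2 + w) * (2 + w) + 2 * (2 + w) * (p + 1))
    m≡1<k = solve-∀
    2≤m<k : ∀ p b w → (2 + b) * (2 + b + 2) + 2 * (2 * p + (2 + b) + 3 * (3 + b + w))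
                        + suc (2 * p + 2 * p * b + 2 * p * w + 2 * b * b + 2 * b + 6 + w * w + 4 * w + 4 * b * w)
                    ≡ 16 + ((3 + b + w) * (3 + b + w) + 2 * (3 + b + w) * (p + (2 + b)))
    2≤m<k = solve-∀

  private
    impossible-k≤m : ∀ p k d → let t = 4 + d ; m = k + d ; Q = k * k + 2 * k * (p + m) ; R = m * (m + 2) in
      t * t + Q ≤ R + 2 * (k * (3 + p + m)) → t * t + Q ≤ R + 2 * (2 * p + m + 3 * k) → ⊥
    impossible-k≤m p 0 d bound₁ bound₂ = slack⇒≰ (Gap.k≡0 p d) bound₁
    impossible-k≤m p 1 d bound₁ bound₂ = slack⇒≰ (Gap.k≡1 p d) bound₁
    impossible-k≤m p 2 d bound₁ bound₂ = slack⇒≰ (Gap.k≡2 p d) bound₂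
    impossible-k≤m p (suc (suc (suc i))) d bound₁ bound₂ = slack⇒≰ (Gap.3≤k≤m p i d) bound₂

    impossible-k>m : ∀ p m w → let k = suc (m + w) ; Q = k * k + 2 * k * (p + m) ; R = m * (m + 2) in
      16 + Q ≤ R + 2 * (k * (3 + p + m)) → 16 + Q ≤ R + 2 * (2 * p + m + 3 * k) → ⊥
    impossible-k>m p 0 0 bound₁ bound₂ = slack⇒≰ (Gap.k≡1∧m≡0 p) bound₁
    impossible-k>m p 0 1 bound₁ bound₂ = slack⇒≰ (Gap.k≡2∧m≡0 p) bound₂
    impossible-k>m p 0 (suc (suc b)) bound₁ bound₂ = slack⇒≰ (Gap.3≤k∧m≡0 p b) bound₂
    impossible-k>m p 1 w bound₁ bound₂ = slack⇒≰ (Gap.m≡1<k p w) bound₂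
    impossible-k>m p (suc (suc b)) w bound₁ bound₂ = slack⇒≰ (Gap.2≤m<k p b w) bound₂

  -- Here X = 4e, N = n², m = ∣C ∖ A∣ − ∣A ∖ C∣ + ∣rest∣ and S is the degree sum over
  -- A ∩ C.  When k ≤ m the square (4 + m − k)² bounds X − N from below, otherwise 16 does.
  excess-impossible : ∀ p m k S X N →
    X + (k * k + 2 * k * (p + m)) ≤ N + (m * (m + 2) + 2 * S) →
    S ≤ k * (3 + p + m) → S ≤ 2 * p + m + 3 * k → 16 + N ≤ X →
    (∀ d → m ≡ k + d → (4 + d) * (4 + d) + N ≤ X) → ⊥
  excess-impossible p m k S X N excess S≤β₁ S≤β₂ 16+N≤X t²+N≤X with dichotomy k m
  ... | k≤m k d = impossible-k≤m p k d (cancel S≤β₁) (cancel S≤β₂)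
    where
    cancel : ∀ {β} → S ≤ β → (4 + d) * (4 + d) + (k * k + 2 * k * (p + (k + d))) ≤ (k + d) * (k + d + 2) + 2 * β
    cancel = ≤-trans-cancel ((4 + d) * (4 + d)) N ((k + d) * (k + d + 2)) excess (t²+N≤X d refl)
  ... | k>m m w = impossible-k>m p m w (cancel S≤β₁) (cancel S≤β₂)
    where
    cancel : ∀ {β} → S ≤ β → let k = suc (m + w) in 16 + (k * k + 2 * k * (p + m)) ≤ m * (m + 2) + 2 * β
    cancel = ≤-trans-cancel 16 N (m * (m + 2)) excess 16+N≤X

  private
    excess-identity : ∀ p s r k S → let n = 2 + p + (p + s) + k + r ; L = 2 + (p + s) + r ; m = s + r in
      2 * ((p + k + 1) + (p + s + k + 1) + (p * n + s * L) + S + r * L) + (k * k + 2 * k * (p + m)) + 2 * r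
        ≡ n * n + (m * (m + 2) + 2 * S)
    excess-identity = solve-∀

  excess-bound : ∀ p s r k S e → let n = 2 + p + (p + s) + k + r ; L = 2 + (p + s) + r ; m = s + r in
    2 * e ≤ (p + k + 1) + (p + s + k + 1) + (p * n + s * L) + S + r * L →
    4 * e + (k * k + 2 * k * (p + m)) ≤ n * n + (m * (m + 2) + 2 * S)
  excess-bound p s r k S e 2e≤D = begin
    4 * e + Q               ≡⟨ cong (_+ Q) (*-assoc 2 2 e) ⟩
    2 * (2 * e) + Q         ≤⟨ +-monoˡ-≤ Q (*-monoʳ-≤ 2 2e≤D) ⟩
    2 * D + Q               ≤⟨ m≤m+n (2 * D + Q) (2 * r) ⟩
    2 * D + Q + 2 * r       ≡⟨ excess-identity p s r k S ⟩
    n * n + (m * (m + 2) + 2 * S) ∎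
    where
    open ≤-Reasoning
    n L m D Q : ℕ
    n = 2 + p + (p + s) + k + r
    L = 2 + (p + s) + r
    m = s + r
    D = (p + k + 1) + (p + s + k + 1) + (p * n + s * L) + S + r * L
    Q = k * k + 2 * k * (p + m)

  square-gap : ∀ {n δ b t X} → δ ≤ b → n + 4 ≡ 2 * b + suc t →
    n + 4 ≤ 2 * δ ⊎ (n + 4 ∸ 2 * δ) * (n + 4 ∸ 2 * δ) + n * n ≤ X →
    suc t * suc t + n * n ≤ X
  square-gap {n} {δ} {b} {t} δ≤b n+4≡ (inj₁ n+4≤2δ) =
    contradiction (≤-trans (≤-reflexive (sym n+4≡)) (≤-trans n+4≤2δ (*-monoʳ-≤ 2 δ≤b))) (m+1+n≰m (2 * b))
  square-gap {n} {δ} {b} {t} δ≤b n+4≡ (inj₂ T²+n²≤X) = ≤-trans (+-monoˡ-≤ (n * n) (*-mono-≤ t<T t<T)) T²+n²≤X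
    where
    open ≤-Reasoning
    t<T : suc t ≤ n + 4 ∸ 2 * δ
    t<T = begin
      suc t                  ≡⟨ m+n∸m≡n (2 * b) (suc t) ⟨
      2 * b + suc t ∸ 2 * b  ≡⟨ cong (_∸ 2 * b) n+4≡ ⟨
      n + 4 ∸ 2 * b          ≤⟨ ∸-monoʳ-≤ (n + 4) (*-monoʳ-≤ 2 δ≤b) ⟩
      n + 4 ∸ 2 * δ          ∎

  private
    n+4-identity : ∀ p s r k → 2 + p + (p + s) + k + r + 4 ≡ 2 * p + k + 6 + (s + r)
    n+4-identity = solve-∀
    gap-identity : ∀ p k d → 2 * p + k + 6 + (k + d) ≡ 2 * (p + k + 1) + (4 + d)
    gap-identity = solve-∀
    β₂-identity : ∀ p s r k → k + k + (p + (p + s) + k + r) ≡ 2 * p + (s + r) + 3 * k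
    β₂-identity = solve-∀

  degree-sum-impossible : ∀ {n L p q k r S e δ} → n ≡ 2 + p + q + k + r → L ≡ 2 + q + r → p ≤ q →
    δ ≤ p + k + 1 → 2 * e ≤ (p + k + 1) + (q + k + 1) + (p * n + (q ∸ p) * L) + S + r * L →
    S ≤ k * suc L → S ≤ k + k + (p + q + k + r) → 16 + n * n ≤ 4 * e →
    n + 4 ≤ 2 * δ ⊎ (n + 4 ∸ 2 * δ) * (n + 4 ∸ 2 * δ) + n * n ≤ 4 * e → ⊥
  degree-sum-impossible {p = p} {q} {k} {r} {S} {e} {δ} refl refl p≤q δ≤ 2e≤D S≤β₁ S≤β₂ 16+n²≤4e hT
    with s , refl ← m≤n⇒∃[o]m+o≡n p≤q =
    excess-impossible p (s + r) k S (4 * e) (n * n) excess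
      (subst (λ z → S ≤ k * (3 + z)) (+-assoc p s r) S≤β₁) (subst (S ≤_) (β₂-identity p s r k) S≤β₂)
      16+n²≤4e (λ d s+r≡k+d → square-gap {n = n} δ≤ (n+4≡ d s+r≡k+d) hT)
    where
    n L : ℕ
    n = 2 + p + (p + s) + k + r
    L = 2 + (p + s) + r
    excess : 4 * e + (k * k + 2 * k * (p + (s + r))) ≤ n * n + ((s + r) * (s + r + 2) + 2 * S)
    excess = excess-bound p s r k S e
      (subst (λ z → 2 * e ≤ (p + k + 1) + (p + s + k + 1) + (p * n + z * L) + S + r * L) (m+n∸m≡n p s) 2e≤D)
    n+4≡ : ∀ d → s + r ≡ k + d → n + 4 ≡ 2 * (p + k + 1) + (4 + d)
    n+4≡ d s+r≡k+d = trans (n+4-identity p s r k) (trans (cong (2 * p + k + 6 +_) s+r≡k+d) (gap-identity p k d))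

module PathsOfLength4 where

  open Counting
  open GraphCounting
  open Arithmetic
  open import Data.Nat using (ℕ; suc; _+_; _*_; _∸_; _≤_; z≤n)
  open import Data.Nat.Properties hiding (_≟_)
  open import Data.Bool using (Bool; true; false; _∧_)
  import Data.Bool as Bool
  open import Data.Fin using (Fin)
  open import Data.Fin.Properties using (_≟_; any?)
  open import Data.Product using (_×_; _,_; proj₁; proj₂)
  open import Data.Bool.Properties using (not-¬)
  open import Data.Sum using (_⊎_; inj₁; inj₂)
  open import Data.Empty using (⊥; ⊥-elim)
  open import Data.List using (List; []; _∷_; map)
  import Data.Nat.ListAction as ListAction
  open import Function using (_∘_)
  open import Data.Nat.Tactic.RingSolver using (solve-∀)
  open import Algebra.Properties.Semiring.Sum +-*-semiring using (sum; sum-syntax)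
  open import Relation.Binary.PropositionalEquality
  open import Relation.Nullary using (¬_; Dec; yes; no; ¬?)
  open import Relation.Nullary.Decidable using (_×-dec_; decidable-stable)
  open import Relation.Nullary.Negation using (contradiction)

  module Configuration {n} (G : Graph n) (x y : Fin n) (x≢y : x ≢ y) where

    A C onlyA onlyC both rest : Fin n → Bool
    A = adj G x ∖ ｛ y ｝
    C = adj G y ∖ ｛ x ｝
    onlyA = A ∖ C
    onlyC = C ∖ A
    both = A ∩ C
    rest = ∁ (｛ x ｝ ∪ ｛ y ｝ ∪ A ∪ C)

    Inner : Fin n → Set
    Inner v = v ≢ x × v ≢ y

    -- Equivalent to ¬ PathOfLength4 G x y: a path x a u c y is an inner u with
    -- distinct neighbours a ∈ A and c ∈ C.
    NoPathOfLength4 : Set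
    NoPathOfLength4 = ∀ {u a c} → Inner u → (adj G u ∩ A) a ≡ true → (adj G u ∩ C) c ≡ true → a ≡ c

    A-elim : ∀ {a} → A a ≡ true → Adj G x a × a ≢ y
    A-elim Aa = proj₁ (∖-elim (adj G x) ｛ y ｝ Aa) , ｛｝-elim (proj₂ (∖-elim (adj G x) ｛ y ｝ Aa))

    C-elim : ∀ {c} → C c ≡ true → Adj G y c × c ≢ x
    C-elim Cc = proj₁ (∖-elim (adj G y) ｛ x ｝ Cc) , ｛｝-elim (proj₂ (∖-elim (adj G y) ｛ x ｝ Cc))

    private
      Config : Fin n → Fin n → Fin n → Set
      Config u a c = Inner u × (adj G u ∩ A) a ≡ true × (adj G u ∩ C) c ≡ true × a ≢ c

      config? : ∀ u a c → Dec (Config u a c)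
      config? u a c = (¬? (u ≟ x) ×-dec ¬? (u ≟ y)) ×-dec (adj G u a ∧ A a) Bool.≟ true
                ×-dec (adj G u c ∧ C c) Bool.≟ true ×-dec ¬? (a ≟ c)

    path-or-no-path : PathOfLength4 G x y ⊎ NoPathOfLength4
    path-or-no-path with any? (λ u → any? (λ a → any? (λ c → config? u a c)))
    ... | yes (u , a , c , cfg) = inj₁ (path cfg)
      where
      path : Config u a c → PathOfLength4 G x y
      path ((u≢x , u≢y) , ua∧Aa , uc∧Cc , a≢c)
        with ua , Aa ← ∩-elim (adj G u) A ua∧Aa | uc , Cc ← ∩-elim (adj G u) C uc∧Cc
        with xa , a≢y ← A-elim Aa | yc , c≢x ← C-elim Cc =
        a , u , c , xa , Adj-sym G ua , uc , Adj-sym G yc ,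
        Adj⇒≢ G xa , u≢x ∘ sym , c≢x ∘ sym , x≢y ,
        Adj⇒≢ G ua ∘ sym , a≢c , a≢y ,
        Adj⇒≢ G uc , u≢y ,
        Adj⇒≢ G yc ∘ sym
    ... | no none = inj₂ λ {u} {a} {c} u-inner ua∧Aa uc∧Cc →
      decidable-stable (a ≟ c) λ a≢c → none (u , a , c , u-inner , ua∧Aa , uc∧Cc , a≢c)

    classes : List (Fin n → Bool)
    classes = ｛ x ｝ ∷ ｛ y ｝ ∷ onlyA ∷ onlyC ∷ both ∷ rest ∷ []

    classes-partition : ∀ v → ListAction.sum (map (λ P → iverson (P v)) classes) ≡ 1
    classes-partition v with v ≟ x | v ≟ y | adj G x v in xv | adj G y v in yv
    ... | yes refl | yes refl | _     | _     = contradiction refl x≢y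
    ... | yes refl | no  _    | true  | _     = contradiction (trans (sym xv) (irreflexive G x)) λ ()
    ... | yes refl | no  _    | false | true  = refl
    ... | yes refl | no  _    | false | false = refl
    ... | no  _    | yes refl | _     | true  = contradiction (trans (sym yv) (irreflexive G y)) λ ()
    ... | no  _    | yes refl | true  | false = refl
    ... | no  _    | yes refl | false | false = refl
    ... | no  _    | no  _    | true  | true  = refl
    ... | no  _    | no  _    | true  | false = refl
    ... | no  _    | no  _    | false | true  = refl
    ... | no  _    | no  _    | false | false = refl

    p q k r : ℕ
    p = ∣ onlyA ∣
    q = ∣ onlyC ∣
    k = ∣ both ∣
    r = ∣ rest ∣

    n≡2+p+q+k+r : n ≡ 2 + p + q + k + r
    n≡2+p+q+k+r = begin
      n                                                      ≡⟨ n≡∑∣class∣ classes classes-partition ⟩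
      ∣ ｛ x ｝ ∣ + (∣ ｛ y ｝ ∣ + (p + (q + (k + (r + 0))))) ≡⟨ cong₂ (λ a b → a + (b + (p + (q + (k + (r + 0))))))
                                                                     (∣｛v｝∣≡1 x) (∣｛v｝∣≡1 y) ⟩
      1 + (1 + (p + (q + (k + (r + 0)))))                   ≡⟨ reassociate p q k r ⟩
      2 + p + q + k + r                                     ∎
      where
      open ≡-Reasoning
      reassociate : ∀ p q k r → 1 + (1 + (p + (q + (k + (r + 0))))) ≡ 2 + p + q + k + r
      reassociate = solve-∀

    sum-by-class : ∀ f →
      sum f ≡ f x + (f y + (sumOn onlyA f + (sumOn onlyC f + (sumOn both f + (sumOn rest f + 0)))))
    sum-by-class f = trans (sum-partition classes classes-partition f)
      (cong₂ (λ a b → a + (b + R)) (sumOn-｛｝ x f) (sumOn-｛｝ y f))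
      where
      R : ℕ
      R = sumOn onlyA f + (sumOn onlyC f + (sumOn both f + (sumOn rest f + 0)))

    ∣A∣≡p+k : ∣ A ∣ ≡ p + k
    ∣A∣≡p+k = ∣P∣≡∣P∖Q∣+∣P∩Q∣ A C

    ∣C∣≡q+k : ∣ C ∣ ≡ q + k
    ∣C∣≡q+k = trans (∣P∣≡∣P∖Q∣+∣P∩Q∣ C A) (cong (q +_) (∣P∩Q∣≡∣Q∩P∣ C A))

    A⇒inner : ∀ {a} → A a ≡ true → Inner a
    A⇒inner Aa = Adj⇒≢ G (proj₁ (A-elim Aa)) ∘ sym , proj₂ (A-elim Aa)

    C⇒inner : ∀ {c} → C c ≡ true → Inner c
    C⇒inner Cc = proj₂ (C-elim Cc) , Adj⇒≢ G (proj₁ (C-elim Cc)) ∘ sym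

    onlyA⇒inner : ∀ {v} → onlyA v ≡ true → Inner v
    onlyA⇒inner = A⇒inner ∘ proj₁ ∘ ∖-elim A C

    onlyC⇒inner : ∀ {v} → onlyC v ≡ true → Inner v
    onlyC⇒inner = C⇒inner ∘ proj₁ ∘ ∖-elim C A

    both⇒inner : ∀ {v} → both v ≡ true → Inner v
    both⇒inner = A⇒inner ∘ proj₁ ∘ ∩-elim A C

    rest⇒inner : ∀ {v} → rest v ≡ true → Inner v
    rest⇒inner {v} Rv with v ≟ x | v ≟ y
    ... | no v≢x | no v≢y = v≢x , v≢y

    onlyC⇒∉both : ∀ {v} → onlyC v ≡ true → both v ≡ false
    onlyC⇒∉both {v} C̃v = cong (_∧ C v) (proj₂ (∖-elim C A C̃v))

    rest⇒∉both : ∀ {v} → rest v ≡ true → both v ≡ false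
    rest⇒∉both {v} Rv with v ≟ x | v ≟ y | A v
    ... | no _ | no _ | false = refl

    module Bounds (no-path : NoPathOfLength4) (∣A∣≤∣C∣ : ∣ A ∣ ≤ ∣ C ∣) where

      L : ℕ
      L = n ∸ ∣ A ∣

      private
        one-common-neighbour : ∀ {u a c} → Inner u → (adj G u ∩ A) a ≡ true → (adj G u ∩ C) c ≡ true →
          degree G u + ∣ A ∣ ≤ iverson (both u) + n
        one-common-neighbour {u} {a} {c} u-inner ua∧Aa uc∧Cc = by-membership
          where
          a≡c : a ≡ c
          a≡c = no-path u-inner ua∧Aa uc∧Cc
          N∩A⊆｛a｝ : ∀ v → (adj G u ∩ A) v ≡ true → v ≡ a
          N∩A⊆｛a｝ v uv∧Av = trans (no-path u-inner uv∧Av uc∧Cc) (sym a≡c)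
          N∩C⊆｛a｝ : ∀ v → (adj G u ∩ C) v ≡ true → v ≡ a
          N∩C⊆｛a｝ v uv∧Cv = sym (no-path u-inner ua∧Aa uv∧Cv)
          by-membership : degree G u + ∣ A ∣ ≤ iverson (both u) + n
          by-membership with A u in Au | C u in Cu
          ... | false | _     = degree+∣P∣≤n G A Au (∣P∣≤1 a N∩A⊆｛a｝)
          ... | true  | true  = ≤-trans (degree+∣P∣≤n+∣N∩P∣ G u A)
                                  (≤-trans (+-monoʳ-≤ n (∣P∣≤1 a N∩A⊆｛a｝)) (≤-reflexive (+-comm n 1)))
          ... | true  | false = ≤-trans (+-monoʳ-≤ (degree G u) ∣A∣≤∣C∣) (degree+∣P∣≤n G C Cu (∣P∣≤1 a N∩C⊆｛a｝))

        no-neighbour-in : ∀ {u} P → ∣ adj G u ∩ P ∣ ≡ 0 → ∣ A ∣ ≤ ∣ P ∣ → degree G u + ∣ A ∣ ≤ iverson (both u) + n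
        no-neighbour-in {u} P ∣N∩P∣≡0 ∣A∣≤∣P∣ = begin
          degree G u + ∣ A ∣     ≤⟨ +-monoʳ-≤ (degree G u) ∣A∣≤∣P∣ ⟩
          degree G u + ∣ P ∣     ≤⟨ degree+∣P∣≤n+∣N∩P∣ G u P ⟩
          n + ∣ adj G u ∩ P ∣    ≡⟨ trans (cong (n +_) ∣N∩P∣≡0) (+-identityʳ n) ⟩
          n                      ≤⟨ m≤n+m n _ ⟩
          iverson (both u) + n   ∎
          where open ≤-Reasoning

      -- Either N(u) misses A or C (and ∣A∣ ≤ ∣C∣), or all of N(u) ∩ (A ∪ C) is a single vertex.
      inner-degree : ∀ {u} → Inner u → degree G u + ∣ A ∣ ≤ iverson (both u) + n
      inner-degree {u} u-inner with member-or-∣∣≡0 (adj G u ∩ A) | member-or-∣∣≡0 (adj G u ∩ C)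
      ... | inj₁ (a , ua∧Aa) | inj₁ (c , uc∧Cc) = one-common-neighbour u-inner ua∧Aa uc∧Cc
      ... | inj₂ ∣N∩A∣≡0     | _                = no-neighbour-in A ∣N∩A∣≡0 ≤-refl
      ... | inj₁ _           | inj₂ ∣N∩C∣≡0     = no-neighbour-in C ∣N∩C∣≡0 ∣A∣≤∣C∣

      degree≤L : ∀ {u} → Inner u → both u ≡ false → degree G u ≤ L
      degree≤L {u} u-inner Bu = m+n≤o⇒m≤o∸n (degree G u)
        (subst (λ b → degree G u + ∣ A ∣ ≤ iverson b + n) Bu (inner-degree u-inner))

      degree≤1+L : ∀ {u} → both u ≡ true → degree G u ≤ suc L
      degree≤1+L {u} Bu = ≤-trans (m+n≤o⇒m≤o∸n (degree G u)
        (subst (λ b → degree G u + ∣ A ∣ ≤ iverson b + n) Bu (inner-degree (both⇒inner Bu))))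
        (≤-reflexive (+-∸-assoc 1 (∣P∣≤n A)))

      onlyA+onlyC-degree≤n : ∀ {a c} → onlyA a ≡ true → onlyC c ≡ true → degree G a + degree G c ≤ n
      onlyA+onlyC-degree≤n {a} {c} Ãa C̃c with member-or-∣∣≡0 (adj G a ∩ adj G c)
      ... | inj₁ (w , aw∧cw) =
        ⊥-elim (no-common-neighbour (∖-elim A C Ãa) (∖-elim C A C̃c) (∩-elim (adj G a) (adj G c) aw∧cw))
        where
        no-common-neighbour : A a ≡ true × C a ≡ false → C c ≡ true × A c ≡ false → ¬ (Adj G a w × Adj G c w)
        no-common-neighbour (Aa , Ca) (Cc , Ac) (aw , cw) with w ≟ x | w ≟ y
        ... | yes refl | _        =
          not-¬ (∖-intro (adj G x) ｛ y ｝ (Adj-sym G cw) (｛｝-intro (proj₂ (C⇒inner Cc)))) Ac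
        ... | no  _    | yes refl =
          not-¬ (∖-intro (adj G y) ｛ x ｝ (Adj-sym G aw) (｛｝-intro (proj₁ (A⇒inner Aa)))) Ca
        ... | no  w≢x  | no  w≢y  = not-¬ (subst (λ v → C v ≡ true) (sym a≡c) Cc) Ca
          where
          a≡c : a ≡ c
          a≡c = no-path (w≢x , w≢y) (∩-intro (adj G w) A (Adj-sym G aw) Aa)
                                    (∩-intro (adj G w) C (Adj-sym G cw) Cc)
      ... | inj₂ ∣N∩N∣≡0 rewrite degree≡∣adj∣ G a | degree≡∣adj∣ G c =
        ≤-trans (∣P∣+∣Q∣≤n+∣P∩Q∣ (adj G a) (adj G c))
                (≤-reflexive (trans (cong (n +_) ∣N∩N∣≡0) (+-identityʳ n)))

      ∣N∩both∣≤1 : ∀ {w} → Inner w → ∣ adj G w ∩ both ∣ ≤ 1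
      ∣N∩both∣≤1 {w} w-inner with member-or-∣∣≡0 (adj G w ∩ both)
      ... | inj₂ ∣N∩B∣≡0    = ≤-trans (≤-reflexive ∣N∩B∣≡0) z≤n
      ... | inj₁ (b , wb∧Bb) = ∣P∣≤1 b (λ v wv∧Bv → no-path w-inner (N∩B⊆N∩A wv∧Bv) (N∩B⊆N∩C wb∧Bb))
        where
        N∩B⊆N∩A : ∀ {v} → (adj G w ∩ both) v ≡ true → (adj G w ∩ A) v ≡ true
        N∩B⊆N∩A {v} wv∧Bv with adj G w v | A v
        ... | true | true = refl
        N∩B⊆N∩C : ∀ {v} → (adj G w ∩ both) v ≡ true → (adj G w ∩ C) v ≡ true
        N∩B⊆N∩C {v} wv∧Bv with adj G w v | A v | C v
        ... | true | true | true = refl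

      private
        S : (Fin n → Bool) → ℕ
        S P = sumOn P (degree G)

        p≤q : p ≤ q
        p≤q = +-cancelʳ-≤ k p q (subst₂ _≤_ ∣A∣≡p+k ∣C∣≡q+k ∣A∣≤∣C∣)

      onlyA+onlyC-sum : S onlyA + S onlyC ≤ p * n + (q ∸ p) * L
      onlyA+onlyC-sum = sumOn-pair-≤ p≤q (degree≤n G) (λ c C̃c → degree≤L (onlyC⇒inner C̃c) (onlyC⇒∉both C̃c))
                                        (λ a c → onlyA+onlyC-degree≤n)

      both-sum≤k*[1+L] : S both ≤ k * suc L
      both-sum≤k*[1+L] = sumOn-≤ (λ b → degree≤1+L {b})

      both-sum≤2k+n-2 : S both ≤ k + k + (p + q + k + r)
      both-sum≤2k+n-2 = begin
        S both                                    ≡⟨ sumOn-degree G both ⟩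
        ∑[ w < n ] ∣ adj G w ∩ both ∣             ≡⟨ sum-by-class (λ w → ∣ adj G w ∩ both ∣) ⟩
        N x + (N y + (S′ onlyA + (S′ onlyC + (S′ both + (S′ rest + 0)))))
          ≤⟨ +-mono-≤ (N≤k x) (+-mono-≤ (N≤k y) (+-mono-≤ (sumOn-≤ (inner-≤1 onlyA onlyA⇒inner))
               (+-mono-≤ (sumOn-≤ (inner-≤1 onlyC onlyC⇒inner)) (+-mono-≤ (sumOn-≤ (inner-≤1 both both⇒inner))
               (+-monoˡ-≤ 0 (sumOn-≤ (inner-≤1 rest rest⇒inner))))))) ⟩
        k + (k + (p * 1 + (q * 1 + (k * 1 + (r * 1 + 0)))))  ≡⟨ reassociate p q k r ⟩
        k + k + (p + q + k + r)                   ∎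
        where
        open ≤-Reasoning
        N : Fin n → ℕ
        N w = ∣ adj G w ∩ both ∣
        S′ : (Fin n → Bool) → ℕ
        S′ P = sumOn P N
        N≤k : ∀ w → N w ≤ k
        N≤k w = ∣∣-mono (λ v → proj₂ ∘ ∩-elim (adj G w) both {v})
        inner-≤1 : ∀ P → (∀ {w} → P w ≡ true → Inner w) → ∀ w → P w ≡ true → N w ≤ 1
        inner-≤1 P P⇒inner w Pw = ∣N∩both∣≤1 (P⇒inner Pw)
        reassociate : ∀ p q k r → k + (k + (p * 1 + (q * 1 + (k * 1 + (r * 1 + 0))))) ≡ k + k + (p + q + k + r)
        reassociate = solve-∀

      rest-sum : S rest ≤ r * L
      rest-sum = sumOn-≤ (λ v Rv → degree≤L (rest⇒inner {v} Rv) (rest⇒∉both Rv))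

      L≡2+q+r : L ≡ 2 + q + r
      L≡2+q+r = trans (cong₂ _∸_ (trans n≡2+p+q+k+r (split p q k r)) ∣A∣≡p+k) (m+n∸m≡n (p + k) (2 + q + r))
        where
        split : ∀ p q k r → 2 + p + q + k + r ≡ p + k + (2 + q + r)
        split = solve-∀

      degree-sum≤ : 2 * edgeCount G ≤ (p + k + 1) + (q + k + 1) + (p * n + (q ∸ p) * L) + S both + r * L
      degree-sum≤ = begin
        2 * edgeCount G
          ≡⟨ trans (sym (handshake G)) (sum-by-class (degree G)) ⟩
        degree G x + (degree G y + (S onlyA + (S onlyC + (S both + (S rest + 0)))))
          ≡⟨ reassociate (degree G x) (degree G y) (S onlyA) (S onlyC) (S both) (S rest) ⟩
        degree G x + degree G y + (S onlyA + S onlyC) + S both + S rest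
          ≤⟨ +-mono-≤ (+-monoˡ-≤ (S both) (+-mono-≤ (+-mono-≤ degree-x≤ degree-y≤) onlyA+onlyC-sum)) rest-sum ⟩
        (p + k + 1) + (q + k + 1) + (p * n + (q ∸ p) * L) + S both + r * L
          ∎
        where
        open ≤-Reasoning
        reassociate : ∀ a b c d e f → a + (b + (c + (d + (e + (f + 0))))) ≡ a + b + (c + d) + e + f
        reassociate = solve-∀
        degree-x≤ : degree G x ≤ p + k + 1
        degree-x≤ = ≤-trans (degree≤∣N∖v∣+1 G x y) (≤-reflexive (cong (_+ 1) ∣A∣≡p+k))
        degree-y≤ : degree G y ≤ q + k + 1
        degree-y≤ = ≤-trans (degree≤∣N∖v∣+1 G y x) (≤-reflexive (cong (_+ 1) ∣C∣≡q+k))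

      no-path-impossible : ∀ {δ} → δ ≤ degree G x → 16 + n * n ≤ 4 * edgeCount G →
        n + 4 ≤ 2 * δ ⊎ (n + 4 ∸ 2 * δ) * (n + 4 ∸ 2 * δ) + n * n ≤ 4 * edgeCount G → ⊥
      no-path-impossible {δ} δ≤dx 16+n²≤4e hT =
        degree-sum-impossible {e = edgeCount G} n≡2+p+q+k+r L≡2+q+r p≤q δ≤p+k+1 degree-sum≤
          both-sum≤k*[1+L] both-sum≤2k+n-2 16+n²≤4e hT
        where
        δ≤p+k+1 : δ ≤ p + k + 1
        δ≤p+k+1 = ≤-trans δ≤dx (≤-trans (degree≤∣N∖v∣+1 G x y) (≤-reflexive (cong (_+ 1) ∣A∣≡p+k)))

  module _ {n} (G : Graph n) where
    open Configuration G

    no-path-sym : ∀ x y x≢y → NoPathOfLength4 x y x≢y → NoPathOfLength4 y x (x≢y ∘ sym)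
    no-path-sym x y x≢y no-path (u≢y , u≢x) ua∧Ca uc∧Ac = sym (no-path (u≢x , u≢y) uc∧Ac ua∧Ca)

    path-of-length-4 : ∀ {δ} → IsMinDegree G δ → 16 + n * n ≤ 4 * edgeCount G →
      n + 4 ≤ 2 * δ ⊎ (n + 4 ∸ 2 * δ) * (n + 4 ∸ 2 * δ) + n * n ≤ 4 * edgeCount G →
      ∀ x y → x ≢ y → PathOfLength4 G x y
    path-of-length-4 (δ≤degree , _) 16+n²≤4e hT x y x≢y with path-or-no-path x y x≢y
    ... | inj₁ path = path
    ... | inj₂ no-path with ≤-total ∣ A x y x≢y ∣ ∣ C x y x≢y ∣
    ...   | inj₁ ∣A∣≤∣C∣ = ⊥-elim (Bounds.no-path-impossible x y x≢y no-path ∣A∣≤∣C∣ (δ≤degree x) 16+n²≤4e hT)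
    ...   | inj₂ ∣C∣≤∣A∣ = ⊥-elim (Bounds.no-path-impossible y x (x≢y ∘ sym) (no-path-sym x y x≢y no-path) ∣C∣≤∣A∣
                                     (δ≤degree y) 16+n²≤4e hT)

module FromIntegers where

  open import Data.Nat as ℕ using (_∸_)
  import Data.Nat.Properties as ℕ
  open import Data.Integer using (+_; -_; _+_; _-_; _*_; _≤_)
  open import Data.Integer.Properties
    using (drop‿+≤+; pos-+; pos-*; +-assoc; +-inverseˡ; +-identityʳ; +-monoˡ-≤; m-n≡m⊖n; ⊖-≥)
  open import Data.Sum using (inj₁; inj₂)
  open import Relation.Binary.PropositionalEquality
  open import Relation.Nullary using (yes; no)

  private
    i-j+j≡i : ∀ i j → i - j + j ≡ i
    i-j+j≡i i j = trans (+-assoc i (- j) j) (trans (cong (λ k → i + k) (+-inverseˡ j)) (+-identityʳ i))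

    ≤-minus⇒+≤ : ∀ {a b c} → + a ≤ + b - + c → a ℕ.+ c ℕ.≤ b
    ≤-minus⇒+≤ {a} {b} {c} a≤b-c =
      drop‿+≤+ (subst₂ _≤_ (sym (pos-+ a c)) (i-j+j≡i (+ b) (+ c)) (+-monoˡ-≤ (+ c) a≤b-c))

    minus-≤⇒≤+ : ∀ {a b c} → + b - + c ≤ + a → b ℕ.≤ a ℕ.+ c
    minus-≤⇒≤+ {a} {b} {c} b-c≤a =
      drop‿+≤+ (subst₂ _≤_ (i-j+j≡i (+ b) (+ c)) (sym (pos-+ a c)) (+-monoˡ-≤ (+ c) b-c≤a))

  excess-from-ℤ : ∀ n e → + 16 ≤ + 4 * + e - + n * + n → 16 ℕ.+ n ℕ.* n ℕ.≤ 4 ℕ.* e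
  excess-from-ℤ n e 16≤4e-n² =
    ≤-minus⇒+≤ (subst₂ (λ i j → + 16 ≤ i - j) (sym (pos-* 4 e)) (sym (pos-* n n)) 16≤4e-n²)

  -- The truncated subtraction n + 4 ∸ 2δ is only produced when 2δ ≤ n + 4.
  gap-from-ℤ : ∀ n δ e →
    + n + + 4 - + 2 * + δ ≤ + 0 ⊎ (+ n + + 4 - + 2 * + δ) * (+ n + + 4 - + 2 * + δ) ≤ + 4 * + e - + n * + n →
    n ℕ.+ 4 ℕ.≤ 2 ℕ.* δ ⊎ (n ℕ.+ 4 ∸ 2 ℕ.* δ) ℕ.* (n ℕ.+ 4 ∸ 2 ℕ.* δ) ℕ.+ n ℕ.* n ℕ.≤ 4 ℕ.* e
  gap-from-ℤ n δ e (inj₁ T≤0) = inj₁ (minus-≤⇒≤+ (subst (_≤ + 0) T≡ T≤0))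
    where
    T≡ : + n + + 4 - + 2 * + δ ≡ + (n ℕ.+ 4) - + (2 ℕ.* δ)
    T≡ = cong₂ _-_ (sym (pos-+ n 4)) (sym (pos-* 2 δ))
  gap-from-ℤ n δ e (inj₂ T²≤4e-n²) with 2 ℕ.* δ ℕ.≤? n ℕ.+ 4
  ... | no  2δ≰n+4 = inj₁ (ℕ.<⇒≤ (ℕ.≰⇒> 2δ≰n+4))
  ... | yes 2δ≤n+4 = inj₂ (≤-minus⇒+≤ (subst₂ _≤_ T²≡ (cong₂ _-_ (sym (pos-* 4 e)) (sym (pos-* n n))) T²≤4e-n²))
    where
    t : ℕ
    t = n ℕ.+ 4 ∸ 2 ℕ.* δ
    T≡ : + n + + 4 - + 2 * + δ ≡ + t
    T≡ = trans (cong₂ _-_ (sym (pos-+ n 4)) (sym (pos-* 2 δ))) (trans (m-n≡m⊖n (n ℕ.+ 4) (2 ℕ.* δ)) (⊖-≥ 2δ≤n+4))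
    T²≡ : (+ n + + 4 - + 2 * + δ) * (+ n + + 4 - + 2 * + δ) ≡ + (t ℕ.* t)
    T²≡ = trans (cong₂ _*_ T≡ T≡) (sym (pos-* t t))

open PathsOfLength4 using (path-of-length-4)
open import Data.Integer using (ℤ; +_; _-_; _*_; _≤_; _+_)

lemma3p2 : (n : ℕ) (G : Graph n) (δ : ℕ) → IsMinDegree G δ →
    (+ 16) ≤ (+ 4) * (+ edgeCount G) - (+ n) * (+ n) →
    ((+ n) + (+ 4) - (+ 2) * (+ δ) ≤ + 0
      ⊎ ((+ n) + (+ 4) - (+ 2) * (+ δ)) * ((+ n) + (+ 4) - (+ 2) * (+ δ))
          ≤ (+ 4) * (+ edgeCount G) - (+ n) * (+ n)) →
    (x y : Fin n) → x ≢ y → PathOfLength4 G x y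
lemma3p2 n G δ min-degree excess gap =
  path-of-length-4 G min-degree (FromIntegers.excess-from-ℤ n (edgeCount G) excess)
    (FromIntegers.gap-from-ℤ n δ (edgeCount G) gap)
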